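{- Let $P_n$ be the path graph of order $n\geq 2$. Then $N_{sp}(P_n)=2$ if $n$ is even and $N_{sp}(P_n)=\frac{3}{2}(n-1)$ if $n$ is odd. Also $N_{sp}(P_1)=1$.
   Context: All graphs are finite, simple, undirected. For $S\subseteq V(G)$, $\overline{S}=V(G)\setminus S$ and $N(v)$ denotes the open neighbourhood of $v$. A set $S$ is a super dominating set of $G$ if every vertex of $\overline{S}$ has a neighbour in $S$ and for every $u\in\overline{S}$ there is $v\in S$ with $N(v)\cap\overline{S}=\{u\}$. The super domination number $\gamma_{sp}(G)$ is the minimum cardinality of a super dominating set of $G$. $N_{sp}(G)$ denotes the number of super dominating sets of $G$ of cardinality $\gamma_{sp}(G)$. $P_n$ is the path on $n$ vertices. -}

module Defs where

open import Data.Nat using (ℕ; suc)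
open import Data.Fin using (Fin; toℕ)
open import Data.Fin.Subset using (Subset; _∈_; _∉_)
open import Data.Product using (Σ; ∃; _×_)
open import Data.Sum using (_⊎_)
open import Data.List using (List; length)
import Data.List.Membership.Propositional as LM
open import Data.List.Relation.Unary.Unique.Propositional using (Unique)
open import Relation.Binary.PropositionalEquality using (_≡_)
open import Relation.Nullary using (¬_)
import Data.Nat.Properties
open import Function.Bundles using (_⇔_)

record Graph : Set₁ where
  field
    order : ℕ
    Adj   : Fin order → Fin order → Set
    sym   : ∀ {u v} → Adj u v → Adj v u
    irrefl : ∀ {u} → ¬ Adj u u
open Graph public

PathAdj : (n : ℕ) → Fin n → Fin n → Set
PathAdj n i j = (toℕ j ≡ suc (toℕ i)) ⊎ (toℕ i ≡ suc (toℕ j))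

private
  lem : ∀ {a : ℕ} → ¬ (a ≡ suc a)
  lem e = Data.Nat.Properties.<-irrefl e (Data.Nat.Properties.n<1+n _)

Path : ℕ → Graph
Path n = record
  { order = n
  ; Adj = PathAdj n
  ; sym = λ { (Data.Sum.inj₁ e) → Data.Sum.inj₂ e ; (Data.Sum.inj₂ e) → Data.Sum.inj₁ e }
  ; irrefl = λ { (Data.Sum.inj₁ e) → lem e ; (Data.Sum.inj₂ e) → lem e }
  }

ExtPrivate : (G : Graph) → Subset (order G) → Fin (order G) → Fin (order G) → Set
ExtPrivate G S v u =
  Adj G v u × u ∉ S × (∀ w → Adj G v w → w ∉ S → w ≡ u)

SuperDominating : (G : Graph) → Subset (order G) → Set
SuperDominating G S =
  (∀ u → u ∉ S → ∃ λ v → v ∈ S × Adj G v u)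
  × (∀ u → u ∉ S → ∃ λ v → v ∈ S × ExtPrivate G S v u)

MinSuperDominating : (G : Graph) → Subset (order G) → Set
MinSuperDominating G S =
  SuperDominating G S
  × (∀ T → SuperDominating G T → Data.Fin.Subset.∣ S ∣ Data.Nat.≤ Data.Fin.Subset.∣ T ∣)

NspIs : Graph → ℕ → Set
NspIs G k = Σ (List (Subset (order G))) λ L →
  length L ≡ k × Unique L × (∀ S → (S LM.∈ L) ⇔ MinSuperDominating G S)

-- A vertex outside S is privately dominated iff it has a neighbour in S whose other
-- neighbour (if any) is not outside S; on a path this is a condition on windows of five
-- consecutive vertices. So the super dominating sets of P_n are the 0/1 words accepted by a
-- five-state automaton, which can moreover return the slack 2|S| − n ≥ 0. Minimum super
-- dominating sets are then the accepted words of least slack, 0 for even n and 1 for odd n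
-- by parity, and counting them is a linear recursion over the automaton: it gives two words
-- of slack 0 for every even n ≥ 2, and three more words of slack 1 at each step from an odd
-- n to n + 2.
module Submission where

open import Defs hiding (sym)
open import Data.Bool using (Bool; true; false; T; not; _∧_; _∨_; _≟_)
open import Data.Bool.Properties using (T-∧; T-∨; T-not-≡; ∧-assoc)
open import Data.Empty using (⊥; ⊥-elim)
open import Data.Fin using (toℕ; zero; suc)
open import Data.Fin.Properties using (toℕ-injective)
open import Data.Fin.Subset using (Side; Subset; _∈_; _∉_; ∣_∣; inside; outside)
open import Data.Fin.Subset.Properties using (drop-there)
open import Data.List using (List; []; _∷_; _++_; length; map; filter)
open import Data.List.Properties using (length-++; filter-++; filter-none; filter-≐)
open import Data.List.Membership.Propositional using () renaming (_∈_ to _∈ₗ_)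
open import Data.List.Membership.Propositional.Properties
  using (∈-map⁺; ∈-map⁻; ∈-++⁺ˡ; ∈-++⁺ʳ; ∈-filter⁺; ∈-filter⁻)
open import Data.List.Relation.Unary.All as All using ()
open import Data.List.Relation.Unary.AllPairs using ([]; _∷_)
open import Data.List.Relation.Unary.Any using (here)
open import Data.List.Relation.Unary.Unique.Propositional using (Unique)
import Data.List.Relation.Unary.Unique.Propositional.Properties as Unique
open import Data.Maybe as Maybe using (Maybe; just; nothing; is-just)
open import Data.Maybe.Properties using () renaming (≡-dec to ≡-decₘ)
open import Data.Nat as ℕ using (ℕ; zero; suc; _+_; _*_; _≤_; _≥_; z≤n; s≤s)
open import Data.Nat.Properties
  using (suc-injective; m≤n⇒m≤1+n; +-suc; *-suc; +-identityʳ; +-cancelʳ-≡; +-cancelˡ-≤; +-monoʳ-≤;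
         *-monoʳ-≤; *-cancelˡ-≤; ≤-antisym; even≢odd)
open import Data.Nat.Tactic.RingSolver using (solve-∀)
open import Data.Product using (∃; _×_; _,_; proj₁; proj₂)
open import Data.Sum using (_⊎_; inj₁; inj₂)
open import Data.Vec using ([]; _∷_; here; there)
open import Data.Vec.Properties using (∷-injectiveʳ)
open import Function using (_∘_; _$_)
open import Function.Bundles using (_⇔_; mk⇔; Equivalence)
open import Relation.Binary.PropositionalEquality
open import Relation.Nullary using (Dec)
open import Relation.Nullary.Decidable using (isYes; toWitness; does)

-- Windows

-- nothing stands for a position beyond an end of the path.
Cell : Set
Cell = Maybe Side

_‼_ : List Cell → ℕ → Cell
[]       ‼ _     = nothing
(c ∷ cs) ‼ zero  = c
(c ∷ cs) ‼ suc k = cs ‼ k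

isInside notOutside : Cell → Bool
isInside (just inside) = true
isInside _             = false
notOutside (just outside) = false
notOutside _              = true

privateCandidate : Cell → Cell → Bool
privateCandidate near far = isInside near ∧ notOutside far

leftCandidate rightCandidate hasPrivateCandidate : List Cell → ℕ → Bool
leftCandidate       cs k = privateCandidate (cs ‼ (1 + k)) (cs ‼ k)
rightCandidate      cs k = privateCandidate (cs ‼ (3 + k)) (cs ‼ (4 + k))
hasPrivateCandidate cs k = leftCandidate cs k ∨ rightCandidate cs k

windowOK : List Cell → ℕ → Bool
windowOK cs k = notOutside (cs ‼ (2 + k)) ∨ hasPrivateCandidate cs k

cells : ∀ {n} → Subset n → List Cell
cells []      = []
cells (b ∷ S) = just b ∷ cells S

-- Vertex x sits at index 2 + toℕ x.
padded : ∀ {n} → Subset n → List Cell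
padded S = nothing ∷ nothing ∷ cells S

padded-∈ : ∀ {n} {S : Subset n} {x} → x ∈ S → padded S ‼ (2 + toℕ x) ≡ just inside
padded-∈ here        = refl
padded-∈ (there x∈S) = padded-∈ x∈S

padded-∉ : ∀ {n} (S : Subset n) x → x ∉ S → padded S ‼ (2 + toℕ x) ≡ just outside
padded-∉ (outside ∷ S) zero    _   = refl
padded-∉ (inside ∷ S)  zero    x∉S = ⊥-elim (x∉S here)
padded-∉ (_ ∷ S)       (suc x) x∉S = padded-∉ S x (x∉S ∘ there)

padded-inside : ∀ {n} (S : Subset n) k → padded S ‼ k ≡ just inside → ∃ λ x → 2 + toℕ x ≡ k × x ∈ S
padded-inside (inside ∷ S) 2                   refl = zero , refl , here
padded-inside (_ ∷ S)      (suc (suc (suc k))) eq   with padded-inside S (2 + k) eq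
... | x , refl , x∈S = suc x , refl , there x∈S

padded-outside : ∀ {n} (S : Subset n) k → padded S ‼ k ≡ just outside → ∃ λ x → 2 + toℕ x ≡ k × x ∉ S
padded-outside (outside ∷ S) 2                   refl = zero , refl , λ ()
padded-outside (_ ∷ S)       (suc (suc (suc k))) eq   with padded-outside S (2 + k) eq
... | x , refl , x∉S = suc x , refl , x∉S ∘ drop-there

windowOK-intro : ∀ cs k → (cs ‼ (2 + k) ≡ just outside → T (hasPrivateCandidate cs k)) → T (windowOK cs k)
windowOK-intro cs k candidate with cs ‼ (2 + k)
... | nothing        = _
... | just inside    = _
... | just outside   = candidate refl

windowOK-elim : ∀ cs k → cs ‼ (2 + k) ≡ just outside → T (windowOK cs k) → T (hasPrivateCandidate cs k)
windowOK-elim cs k out ok rewrite out = ok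

privateCandidate-intro : ∀ {c d} → c ≡ just inside → T (notOutside d) → T (privateCandidate c d)
privateCandidate-intro refl ok = ok

privateCandidate-elim : ∀ {c d} → T (privateCandidate c d) → c ≡ just inside × T (notOutside d)
privateCandidate-elim {just inside} ok = refl , ok

notOutside-intro : ∀ {c} → c ≢ just outside → T (notOutside c)
notOutside-intro {nothing}      _    = _
notOutside-intro {just inside}  _    = _
notOutside-intro {just outside} ¬out = ¬out refl

notOutside-elim : ∀ {c} → T (notOutside c) → c ≢ just outside
notOutside-elim {just outside} () refl

n≢2+n : ∀ {m} → m ≢ 2 + m
n≢2+n ()

module _ {n : ℕ} (S : Subset n) where

  extPrivate-intro : ∀ {u v} f → u ∉ S → PathAdj n v u →
                     (∀ w → PathAdj n v w → w ≡ u ⊎ 2 + toℕ w ≡ f) →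
                     T (notOutside (padded S ‼ f)) → ExtPrivate (Path n) S v u
  extPrivate-intro {u} {v} f u∉S vu others ok = vu , u∉S , onlyU
    where
    onlyU : ∀ w → PathAdj n v w → w ∉ S → w ≡ u
    onlyU w vw w∉S with others w vw
    ... | inj₁ w≡u = w≡u
    ... | inj₂ atF = ⊥-elim (notOutside-elim ok (trans (cong (padded S ‼_) (sym atF)) (padded-∉ S w w∉S)))

  extPrivate⇒notOutside : ∀ {u v} f → ExtPrivate (Path n) S v u →
                          (∀ x → 2 + toℕ x ≡ f → PathAdj n v x × x ≢ u) →
                          T (notOutside (padded S ‼ f))
  extPrivate⇒notOutside f (_ , _ , onlyU) atF = notOutside-intro λ out →
    let x , e , x∉S = padded-outside S f out
        vx , x≢u    = atF x e
    in  x≢u (onlyU x vx x∉S)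

  extPrivateˡ⇒candidate : ∀ {u v} → toℕ u ≡ suc (toℕ v) → v ∈ S → ExtPrivate (Path n) S v u →
                          T (leftCandidate (padded S) (toℕ u))
  extPrivateˡ⇒candidate {u} {v} tu v∈S priv =
    subst (T ∘ leftCandidate (padded S)) (sym tu)
      (privateCandidate-intro (padded-∈ v∈S) (extPrivate⇒notOutside (suc (toℕ v)) priv λ x e →
        inj₂ (sym (suc-injective e)) , λ { refl → n≢2+n (trans tu (sym (cong suc (suc-injective e)))) }))

  extPrivateʳ⇒candidate : ∀ {u v} → toℕ v ≡ suc (toℕ u) → v ∈ S → ExtPrivate (Path n) S v u →
                          T (rightCandidate (padded S) (toℕ u))
  extPrivateʳ⇒candidate {u} tv v∈S priv =
    privateCandidate-intro (trans (cong (λ i → padded S ‼ (2 + i)) (sym tv)) (padded-∈ v∈S))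
      (extPrivate⇒notOutside (4 + toℕ u) priv λ x e →
        let tx = suc-injective (suc-injective e) in
        inj₁ (trans tx (cong suc (sym tv))) , λ { refl → n≢2+n tx })

  candidateˡ⇒extPrivate : ∀ {u} → u ∉ S → T (leftCandidate (padded S) (toℕ u)) →
                          ∃ λ v → v ∈ S × ExtPrivate (Path n) S v u
  candidateˡ⇒extPrivate {u} u∉S ok with privateCandidate-elim ok
  ... | near , far with padded-inside S (1 + toℕ u) near
  ... | v , e , v∈S = v , v∈S , extPrivate-intro (toℕ u) u∉S (inj₁ tu) others far
    where
    tu : toℕ u ≡ suc (toℕ v)
    tu = sym (suc-injective e)
    others : ∀ w → PathAdj n v w → w ≡ u ⊎ 2 + toℕ w ≡ toℕ u
    others w (inj₁ wv) = inj₁ (toℕ-injective (trans wv (sym tu)))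
    others w (inj₂ vw) = inj₂ (trans (cong suc (sym vw)) (sym tu))

  candidateʳ⇒extPrivate : ∀ {u} → u ∉ S → T (rightCandidate (padded S) (toℕ u)) →
                          ∃ λ v → v ∈ S × ExtPrivate (Path n) S v u
  candidateʳ⇒extPrivate {u} u∉S ok with privateCandidate-elim ok
  ... | near , far with padded-inside S (3 + toℕ u) near
  ... | v , e , v∈S = v , v∈S , extPrivate-intro (4 + toℕ u) u∉S (inj₂ tv) others far
    where
    tv : toℕ v ≡ suc (toℕ u)
    tv = suc-injective (suc-injective e)
    others : ∀ w → PathAdj n v w → w ≡ u ⊎ 2 + toℕ w ≡ 4 + toℕ u
    others w (inj₁ wv) = inj₂ (cong (2 +_) (trans wv (cong suc tv)))
    others w (inj₂ vw) = inj₁ (toℕ-injective (suc-injective (trans (sym vw) tv)))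

  extPrivate⇒hasCandidate : ∀ {u v} → v ∈ S → ExtPrivate (Path n) S v u →
                            T (hasPrivateCandidate (padded S) (toℕ u))
  extPrivate⇒hasCandidate v∈S priv@(inj₁ tu , _) =
    Equivalence.from T-∨ (inj₁ (extPrivateˡ⇒candidate tu v∈S priv))
  extPrivate⇒hasCandidate v∈S priv@(inj₂ tv , _) =
    Equivalence.from T-∨ (inj₂ (extPrivateʳ⇒candidate tv v∈S priv))

  hasCandidate⇒extPrivate : ∀ {u} → u ∉ S → T (hasPrivateCandidate (padded S) (toℕ u)) →
                            ∃ λ v → v ∈ S × ExtPrivate (Path n) S v u
  hasCandidate⇒extPrivate u∉S ok with Equivalence.to T-∨ ok
  ... | inj₁ left  = candidateˡ⇒extPrivate u∉S left
  ... | inj₂ right = candidateʳ⇒extPrivate u∉S right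

  superDominating⇔windowsOK : SuperDominating (Path n) S ⇔ (∀ k → T (windowOK (padded S) k))
  superDominating⇔windowsOK = mk⇔ windowsOK superDominating
    where
    windowsOK : SuperDominating (Path n) S → ∀ k → T (windowOK (padded S) k)
    windowsOK (_ , hasPrivate) k = windowOK-intro (padded S) k λ out →
      let u , e , u∉S    = padded-outside S (2 + k) out
          v , v∈S , priv = hasPrivate u u∉S
      in  subst (T ∘ hasPrivateCandidate (padded S)) (suc-injective (suc-injective e))
                (extPrivate⇒hasCandidate v∈S priv)
    superDominating : (∀ k → T (windowOK (padded S) k)) → SuperDominating (Path n) S
    superDominating ok = (λ u u∉S → let v , v∈S , vu , _ = hasPrivate u u∉S in v , v∈S , vu) , hasPrivate
      where
      hasPrivate : ∀ u → u ∉ S → ∃ λ v → v ∈ S × ExtPrivate (Path n) S v u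
      hasPrivate u u∉S = hasCandidate⇒extPrivate u∉S
        (windowOK-elim (padded S) (toℕ u) (padded-∉ S u u∉S) (ok (toℕ u)))

allWindowsOK : List Cell → Bool
allWindowsOK []       = true
allWindowsOK (c ∷ cs) = windowOK (c ∷ cs) 0 ∧ allWindowsOK cs

allWindowsOK⇔ : ∀ cs → T (allWindowsOK cs) ⇔ (∀ k → T (windowOK cs k))
allWindowsOK⇔ cs = mk⇔ (every cs) (all cs)
  where
  every : ∀ cs → T (allWindowsOK cs) → ∀ k → T (windowOK cs k)
  every []       _  _       = _
  every (c ∷ cs) ok zero    = proj₁ (Equivalence.to T-∧ ok)
  every (c ∷ cs) ok (suc k) = every cs (proj₂ (Equivalence.to T-∧ ok)) k
  all : ∀ cs → (∀ k → T (windowOK cs k)) → T (allWindowsOK cs)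
  all []       _  = _
  all (c ∷ cs) ok = Equivalence.from T-∧ (ok 0 , all cs (ok ∘ suc))

-- The automaton

windowsOver : List Cell → List Cell → Bool
windowsOver []      r = true
windowsOver (c ∷ P) r = windowOK (c ∷ P ++ r) 0 ∧ windowsOver P r

allWindowsOK-++ : ∀ P r → allWindowsOK (P ++ r) ≡ windowsOver P r ∧ allWindowsOK r
allWindowsOK-++ []      r = refl
allWindowsOK-++ (c ∷ P) r = trans (cong (windowOK (c ∷ P ++ r) 0 ∧_) (allWindowsOK-++ P r))
                                  (sym (∧-assoc (windowOK (c ∷ P ++ r) 0) (windowsOver P r) (allWindowsOK r)))

firstFour : List Cell → List Cell
firstFour r = r ‼ 0 ∷ r ‼ 1 ∷ r ‼ 2 ∷ r ‼ 3 ∷ []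

‼-++-firstFour : ∀ P r j → j ≤ 3 → (P ++ r) ‼ j ≡ (P ++ firstFour r) ‼ j
‼-++-firstFour []      r 0                         _         = refl
‼-++-firstFour []      r 1                         _         = refl
‼-++-firstFour []      r 2                         _         = refl
‼-++-firstFour []      r 3                         _         = refl
‼-++-firstFour []      r (suc (suc (suc (suc _)))) (s≤s (s≤s (s≤s ())))
‼-++-firstFour (c ∷ P) r zero                      _         = refl
‼-++-firstFour (c ∷ P) r (suc j)                   (s≤s j≤2) = ‼-++-firstFour P r j (m≤n⇒m≤1+n j≤2)

windowOK-head : ∀ c xs ys → (∀ j → j ≤ 3 → xs ‼ j ≡ ys ‼ j) → windowOK (c ∷ xs) 0 ≡ windowOK (c ∷ ys) 0
windowOK-head c xs ys same
  rewrite same 0 z≤n | same 1 (s≤s z≤n) | same 2 (s≤s (s≤s z≤n)) | same 3 (s≤s (s≤s (s≤s z≤n))) = refl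

windowsOver-firstFour : ∀ P r → windowsOver P r ≡ windowsOver P (firstFour r)
windowsOver-firstFour []      r = refl
windowsOver-firstFour (c ∷ P) r =
  cong₂ _∧_ (windowOK-head c (P ++ r) (P ++ firstFour r) (‼-++-firstFour P r)) (windowsOver-firstFour P r)

∀ᶜ : (Cell → Bool) → Bool
∀ᶜ p = p nothing ∧ p (just outside) ∧ p (just inside)

∀ᶜ-sound-rest : ∀ p → T (∀ᶜ p) → T (p (just outside) ∧ p (just inside))
∀ᶜ-sound-rest p ok = proj₂ (Equivalence.to (T-∧ {p nothing}) ok)

∀ᶜ-sound : ∀ p → T (∀ᶜ p) → ∀ c → T (p c)
∀ᶜ-sound p ok nothing        = proj₁ (Equivalence.to (T-∧ {p nothing}) ok)
∀ᶜ-sound p ok (just outside) = proj₁ (Equivalence.to (T-∧ {p (just outside)}) (∀ᶜ-sound-rest p ok))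
∀ᶜ-sound p ok (just inside)  = proj₂ (Equivalence.to (T-∧ {p (just outside)}) (∀ᶜ-sound-rest p ok))

everyWord : ℕ → (List Cell → Bool) → Bool
everyWord zero    p = p []
everyWord (suc k) p = ∀ᶜ λ c → everyWord k (p ∘ (c ∷_))

everyWord-sound : ∀ k p → T (everyWord k p) → ∀ cs → length cs ≡ k → T (p cs)
everyWord-sound zero    p ok []       refl = ok
everyWord-sound (suc k) p ok (c ∷ cs) refl =
  everyWord-sound k (p ∘ (c ∷_)) (∀ᶜ-sound (λ c → everyWord k (p ∘ (c ∷_))) ok c) cs refl

-- The windows over a prefix see only the first four cells of what follows it,
-- so these are decided by evaluation.
interchangeable : List Cell → List Cell → Bool
interchangeable P P′ = everyWord 4 λ r → isYes (windowsOver P r ≟ windowsOver P′ r)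

rejecting : List Cell → Bool
rejecting P = everyWord 4 λ r → not (windowsOver P r)

interchangeable-sound : ∀ P P′ → T (interchangeable P P′) →
                        ∀ r → allWindowsOK (P ++ r) ≡ allWindowsOK (P′ ++ r)
interchangeable-sound P P′ ok r = begin
  allWindowsOK (P ++ r)              ≡⟨ allWindowsOK-++ P r ⟩
  windowsOver P r ∧ allWindowsOK r   ≡⟨ cong (_∧ allWindowsOK r) sameOver ⟩
  windowsOver P′ r ∧ allWindowsOK r  ≡⟨ allWindowsOK-++ P′ r ⟨
  allWindowsOK (P′ ++ r)             ∎
  where
  open ≡-Reasoning
  sameOnFirstFour : windowsOver P (firstFour r) ≡ windowsOver P′ (firstFour r)
  sameOnFirstFour =
    toWitness (everyWord-sound 4 (λ r → isYes (windowsOver P r ≟ windowsOver P′ r)) ok (firstFour r) refl)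
  sameOver : windowsOver P r ≡ windowsOver P′ r
  sameOver = trans (windowsOver-firstFour P r) (trans sameOnFirstFour (sym (windowsOver-firstFour P′ r)))

rejecting-sound : ∀ P → T (rejecting P) → ∀ r → allWindowsOK (P ++ r) ≡ false
rejecting-sound P ok r = begin
  allWindowsOK (P ++ r)              ≡⟨ allWindowsOK-++ P r ⟩
  windowsOver P r ∧ allWindowsOK r   ≡⟨ cong (_∧ allWindowsOK r) noneOver ⟩
  false                              ∎
  where
  open ≡-Reasoning
  noneOver : windowsOver P r ≡ false
  noneOver = trans (windowsOver-firstFour P r)
                   (Equivalence.to T-not-≡ (everyWord-sound 4 (not ∘ windowsOver P) ok (firstFour r) refl))

-- The state after reading a prefix from left to right:
--   idle     nothing is owed, and the last vertex (if any) cannot privately dominate its successor;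
--   pending  the last vertex is outside S and has no private neighbour yet;
--   ready    the last vertex is in S and can privately dominate its successor;
--   served   the last vertex is outside S and privately dominated by its predecessor;
--   claimed  the last vertex is in S and must privately dominate the pending vertex before it.
data State : Set where
  idle pending ready served claimed : State

slack : State → ∀ {n} → Subset n → Maybe ℕ
slack idle    []            = just 0
slack pending []            = nothing
slack ready   []            = just 1
slack served  []            = just 0
slack claimed []            = just 0
slack idle    (outside ∷ S) = slack pending S
slack idle    (inside ∷ S)  = slack ready S
slack pending (outside ∷ S) = nothing
slack pending (inside ∷ S)  = slack claimed S
slack ready   (outside ∷ S) = slack served S
slack ready   (inside ∷ S)  = Maybe.map suc (slack ready S)
slack served  (outside ∷ S) = slack pending S
slack served  (inside ∷ S)  = Maybe.map suc (slack idle S)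
slack claimed (outside ∷ S) = nothing
slack claimed (inside ∷ S)  = slack ready S

-- A prefix of padded cells after which the automaton is in the given state.
context : State → List Cell
context idle    = nothing ∷ nothing ∷ []
context pending = nothing ∷ nothing ∷ just outside ∷ []
context ready   = nothing ∷ just inside ∷ []
context served  = nothing ∷ just inside ∷ just outside ∷ []
context claimed = nothing ∷ nothing ∷ just outside ∷ just inside ∷ []

is-just-map : ∀ {A B : Set} (f : A → B) m → is-just (Maybe.map f m) ≡ is-just m
is-just-map f nothing  = refl
is-just-map f (just _) = refl

allWindowsOK-context : ∀ q {n} (S : Subset n) → allWindowsOK (context q ++ cells S) ≡ is-just (slack q S)
allWindowsOK-context idle    []            = refl
allWindowsOK-context pending []            = refl
allWindowsOK-context ready   []            = refl
allWindowsOK-context served  []            = refl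
allWindowsOK-context claimed []            = refl
allWindowsOK-context idle    (outside ∷ S) = allWindowsOK-context pending S
allWindowsOK-context idle    (inside ∷ S)  =
  trans (interchangeable-sound (context idle ++ just inside ∷ []) (context ready) _ (cells S))
        (allWindowsOK-context ready S)
allWindowsOK-context pending (outside ∷ S) = rejecting-sound (context pending ++ just outside ∷ []) _ (cells S)
allWindowsOK-context pending (inside ∷ S)  = allWindowsOK-context claimed S
allWindowsOK-context ready   (outside ∷ S) = allWindowsOK-context served S
allWindowsOK-context ready   (inside ∷ S)  =
  trans (interchangeable-sound (context ready ++ just inside ∷ []) (context ready) _ (cells S))
        (trans (allWindowsOK-context ready S) (sym (is-just-map suc (slack ready S))))
allWindowsOK-context served  (outside ∷ S) =
  trans (interchangeable-sound (context served ++ just outside ∷ []) (context pending) _ (cells S))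
        (allWindowsOK-context pending S)
allWindowsOK-context served  (inside ∷ S)  =
  trans (interchangeable-sound (context served ++ just inside ∷ []) (context idle) _ (cells S))
        (trans (allWindowsOK-context idle S) (sym (is-just-map suc (slack idle S))))
allWindowsOK-context claimed (outside ∷ S) = rejecting-sound (context claimed ++ just outside ∷ []) _ (cells S)
allWindowsOK-context claimed (inside ∷ S)  =
  trans (interchangeable-sound (context claimed ++ just inside ∷ []) (context ready) _ (cells S))
        (allWindowsOK-context ready S)

superDominating⇔accepted : ∀ {n} (S : Subset n) → SuperDominating (Path n) S ⇔ T (is-just (slack idle S))
superDominating⇔accepted S = mk⇔
  (λ sd → subst T (allWindowsOK-context idle S)
            (Equivalence.from (allWindowsOK⇔ (padded S)) (Equivalence.to (superDominating⇔windowsOK S) sd)))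
  (λ acc → Equivalence.from (superDominating⇔windowsOK S)
             (Equivalence.to (allWindowsOK⇔ (padded S)) (subst T (sym (allWindowsOK-context idle S)) acc)))

is-just⇒≡just : ∀ {A : Set} {m : Maybe A} → T (is-just m) → ∃ λ a → m ≡ just a
is-just⇒≡just {m = just a} _ = a , refl

superDominating⇒slack : ∀ {n} (S : Subset n) → SuperDominating (Path n) S → ∃ λ s → slack idle S ≡ just s
superDominating⇒slack S = is-just⇒≡just ∘ Equivalence.to (superDominating⇔accepted S)

slack⇒superDominating : ∀ {n} (S : Subset n) {s} → slack idle S ≡ just s → SuperDominating (Path n) S
slack⇒superDominating S eq = Equivalence.from (superDominating⇔accepted S) (subst (T ∘ is-just) (sym eq) _)

-- Slack and cardinality

offset : State → ℕ
offset idle    = 1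
offset pending = 2
offset ready   = 0
offset served  = 1
offset claimed = 1

private
  weight-outside : ∀ c n s {o} → 2 * c + 1 ≡ n + s + suc o → 2 * c + 1 ≡ suc n + s + o
  weight-outside c n s {o} eq = trans eq (+-suc (n + s) o)

  weight-inside : ∀ c n s {o} → 2 * c + 1 ≡ n + s + o → 2 * suc c + 1 ≡ suc n + s + suc o
  weight-inside c n s {o} eq =
    trans (cong (_+ 1) (*-suc 2 c)) (trans (cong (2 +_) eq) (sym (cong suc (+-suc (n + s) o))))

  weight-inside-suc : ∀ c n s {o} → 2 * c + 1 ≡ n + s + o → 2 * suc c + 1 ≡ suc n + suc s + o
  weight-inside-suc c n s {o} eq =
    trans (cong (_+ 1) (*-suc 2 c)) (trans (cong (2 +_) eq) (cong (λ m → suc (m + o)) (sym (+-suc n s))))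

slack-weight : ∀ q {n} (S : Subset n) {s} → slack q S ≡ just s → 2 * ∣ S ∣ + 1 ≡ n + s + offset q
slack-weight idle    []                refl = refl
slack-weight ready   []                refl = refl
slack-weight served  []                refl = refl
slack-weight claimed []                refl = refl
slack-weight idle    {suc n} (outside ∷ S) {s} eq = weight-outside ∣ S ∣ n s (slack-weight pending S eq)
slack-weight idle    {suc n} (inside ∷ S)  {s} eq = weight-inside ∣ S ∣ n s (slack-weight ready S eq)
slack-weight pending {suc n} (inside ∷ S)  {s} eq = weight-inside ∣ S ∣ n s (slack-weight claimed S eq)
slack-weight ready   {suc n} (outside ∷ S) {s} eq = weight-outside ∣ S ∣ n s (slack-weight served S eq)
slack-weight ready   {suc n} (inside ∷ S)      eq with slack ready S in e
... | just s with refl ← eq = weight-inside-suc ∣ S ∣ n s (slack-weight ready S e)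
slack-weight served  {suc n} (outside ∷ S) {s} eq = weight-outside ∣ S ∣ n s (slack-weight pending S eq)
slack-weight served  {suc n} (inside ∷ S)      eq with slack idle S in e
... | just s with refl ← eq = weight-inside-suc ∣ S ∣ n s (slack-weight idle S e)
slack-weight claimed {suc n} (inside ∷ S)  {s} eq = weight-inside ∣ S ∣ n s (slack-weight ready S eq)

card-slack : ∀ {n} (S : Subset n) {s} → slack idle S ≡ just s → 2 * ∣ S ∣ ≡ n + s
card-slack {n} S {s} eq = +-cancelʳ-≡ 1 (2 * ∣ S ∣) (n + s) (slack-weight idle S eq)

card-≤⇔slack-≤ : ∀ {n} (S T : Subset n) {s t} → slack idle S ≡ just s → slack idle T ≡ just t →
                 ∣ S ∣ ≤ ∣ T ∣ ⇔ s ≤ t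
card-≤⇔slack-≤ {n} S T eqS eqT = mk⇔
  (λ le → +-cancelˡ-≤ n _ _ (subst₂ _≤_ (card-slack S eqS) (card-slack T eqT) (*-monoʳ-≤ 2 le)))
  (λ le → *-cancelˡ-≤ 2 (subst₂ _≤_ (sym (card-slack S eqS)) (sym (card-slack T eqT)) (+-monoʳ-≤ n le)))

slack-odd-positive : ∀ k (T : Subset (1 + 2 * k)) {t} → slack idle T ≡ just t → 1 ≤ t
slack-odd-positive k T {zero}  eq = ⊥-elim (even≢odd ∣ T ∣ k (trans (card-slack T eq) (+-identityʳ _)))
slack-odd-positive k T {suc t} _  = s≤s z≤n

-- Counting

_≟ₘ_ : (m m′ : Maybe ℕ) → Dec (m ≡ m′)
_≟ₘ_ = ≡-decₘ ℕ._≟_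

fibre : ∀ {A : Set} → (A → Maybe ℕ) → ℕ → List A → List A
fibre f s = filter (λ x → f x ≟ₘ just s)

length-fibre-map : ∀ {A B : Set} (f : B → Maybe ℕ) (g : A → B) s xs →
                   length (fibre f s (map g xs)) ≡ length (fibre (f ∘ g) s xs)
length-fibre-map f g s []       = refl
length-fibre-map f g s (x ∷ xs) with does (f (g x) ≟ₘ just s)
... | true  = cong suc (length-fibre-map f g s xs)
... | false = length-fibre-map f g s xs

fibre-nothing : ∀ {A : Set} s (xs : List A) → fibre (λ _ → nothing) s xs ≡ []
fibre-nothing s []       = refl
fibre-nothing s (x ∷ xs) = fibre-nothing s xs

fibre-map-suc-zero : ∀ {A : Set} (f : A → Maybe ℕ) xs → fibre (Maybe.map suc ∘ f) 0 xs ≡ []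
fibre-map-suc-zero f xs = filter-none (λ x → Maybe.map suc (f x) ≟ₘ just 0) (All.universal (never ∘ f) xs)
  where
  never : ∀ m → Maybe.map suc m ≢ just 0
  never nothing  ()
  never (just _) ()

fibre-map-suc : ∀ {A : Set} (f : A → Maybe ℕ) s xs → fibre (Maybe.map suc ∘ f) (suc s) xs ≡ fibre f s xs
fibre-map-suc f s =
  filter-≐ (λ x → Maybe.map suc (f x) ≟ₘ just (suc s)) (λ x → f x ≟ₘ just s) (peel , unpeel)
  where
  peel : ∀ {x} → Maybe.map suc (f x) ≡ just (suc s) → f x ≡ just s
  peel {x} eq with f x
  peel refl | just _ = refl
  unpeel : ∀ {x} → f x ≡ just s → Maybe.map suc (f x) ≡ just (suc s)
  unpeel eq rewrite eq = refl

allSubsets : ∀ n → List (Subset n)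
allSubsets zero    = [] ∷ []
allSubsets (suc n) = map (inside ∷_) (allSubsets n) ++ map (outside ∷_) (allSubsets n)

∈-allSubsets : ∀ {n} (S : Subset n) → S ∈ₗ allSubsets n
∈-allSubsets []            = here refl
∈-allSubsets (inside ∷ S)  = ∈-++⁺ˡ (∈-map⁺ (inside ∷_) (∈-allSubsets S))
∈-allSubsets (outside ∷ S) =
  ∈-++⁺ʳ (map (inside ∷_) (allSubsets _)) (∈-map⁺ (outside ∷_) (∈-allSubsets S))

allSubsets-unique : ∀ n → Unique (allSubsets n)
allSubsets-unique zero    = All.[] ∷ []
allSubsets-unique (suc n) =
  Unique.++⁺ (Unique.map⁺ ∷-injectiveʳ (allSubsets-unique n))
             (Unique.map⁺ ∷-injectiveʳ (allSubsets-unique n))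
             disjoint
  where
  disjoint : ∀ {S} → S ∈ₗ map (inside ∷_) (allSubsets n) × S ∈ₗ map (outside ∷_) (allSubsets n) → ⊥
  disjoint (inMap , outMap) with ∈-map⁻ (inside ∷_) inMap | ∈-map⁻ (outside ∷_) outMap
  ... | _ , _ , refl | _ , _ , ()

count : State → ℕ → ℕ → ℕ
count q s n = length (fibre (slack q) s (allSubsets n))

count-suc : ∀ q s n → count q s (suc n) ≡ length (fibre (slack q ∘ (inside ∷_)) s (allSubsets n))
                                          + length (fibre (slack q ∘ (outside ∷_)) s (allSubsets n))
count-suc q s n = begin
  length (fibre (slack q) s (ins ++ outs))
    ≡⟨ cong length (filter-++ (λ S → slack q S ≟ₘ just s) ins outs) ⟩
  length (fibre (slack q) s ins ++ fibre (slack q) s outs)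
    ≡⟨ length-++ (fibre (slack q) s ins) ⟩
  length (fibre (slack q) s ins) + length (fibre (slack q) s outs)
    ≡⟨ cong₂ _+_ (length-fibre-map (slack q) (inside ∷_) s (allSubsets n))
                 (length-fibre-map (slack q) (outside ∷_) s (allSubsets n)) ⟩
  length (fibre (slack q ∘ (inside ∷_)) s (allSubsets n))
    + length (fibre (slack q ∘ (outside ∷_)) s (allSubsets n))
    ∎
  where
  open ≡-Reasoning
  ins outs : List (Subset (suc n))
  ins  = map (inside ∷_) (allSubsets n)
  outs = map (outside ∷_) (allSubsets n)

count-idle : ∀ s n → count idle s (suc n) ≡ count ready s n + count pending s n
count-idle s n = count-suc idle s n

count-pending : ∀ s n → count pending s (suc n) ≡ count claimed s n
count-pending s n = trans (count-suc pending s n)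
  (trans (cong (λ xs → count claimed s n + length xs) (fibre-nothing s (allSubsets n))) (+-identityʳ _))

count-claimed : ∀ s n → count claimed s (suc n) ≡ count ready s n
count-claimed s n = trans (count-suc claimed s n)
  (trans (cong (λ xs → count ready s n + length xs) (fibre-nothing s (allSubsets n))) (+-identityʳ _))

count-ready-zero : ∀ n → count ready 0 (suc n) ≡ count served 0 n
count-ready-zero n = trans (count-suc ready 0 n)
  (cong (λ xs → length xs + count served 0 n) (fibre-map-suc-zero (slack ready) (allSubsets n)))

count-ready-suc : ∀ s n → count ready (suc s) (suc n) ≡ count ready s n + count served (suc s) n
count-ready-suc s n = trans (count-suc ready (suc s) n)
  (cong (λ xs → length xs + count served (suc s) n) (fibre-map-suc (slack ready) s (allSubsets n)))

count-served-zero : ∀ n → count served 0 (suc n) ≡ count pending 0 n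
count-served-zero n = trans (count-suc served 0 n)
  (cong (λ xs → length xs + count pending 0 n) (fibre-map-suc-zero (slack idle) (allSubsets n)))

count-served-suc : ∀ s n → count served (suc s) (suc n) ≡ count idle s n + count pending (suc s) n
count-served-suc s n = trans (count-suc served (suc s) n)
  (cong (λ xs → length xs + count pending (suc s) n) (fibre-map-suc (slack idle) s (allSubsets n)))

count-served-claimed-even : ∀ k → count served 0 (2 * k) ≡ 1 × count claimed 0 (2 * k) ≡ 1
count-served-claimed-even zero    = refl , refl
count-served-claimed-even (suc k) =
  subst (λ n → count served 0 n ≡ 1 × count claimed 0 n ≡ 1) (sym (*-suc 2 k))
    ( trans (count-served-zero (1 + 2 * k)) (trans (count-pending 0 (2 * k)) (proj₂ even))
    , trans (count-claimed 0 (1 + 2 * k)) (trans (count-ready-zero (2 * k)) (proj₁ even)))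
  where
  even : count served 0 (2 * k) ≡ 1 × count claimed 0 (2 * k) ≡ 1
  even = count-served-claimed-even k

count-idle-even : ∀ k → count idle 0 (2 * suc k) ≡ 2
count-idle-even k = subst (λ n → count idle 0 n ≡ 2) (sym (*-suc 2 k)) $ begin
  count idle 0 (2 + 2 * k)
    ≡⟨ count-idle 0 (1 + 2 * k) ⟩
  count ready 0 (1 + 2 * k) + count pending 0 (1 + 2 * k)
    ≡⟨ cong₂ _+_ (count-ready-zero (2 * k)) (count-pending 0 (2 * k)) ⟩
  count served 0 (2 * k) + count claimed 0 (2 * k)
    ≡⟨ cong₂ _+_ (proj₁ even) (proj₂ even) ⟩
  2
    ∎
  where
  open ≡-Reasoning
  even : count served 0 (2 * k) ≡ 1 × count claimed 0 (2 * k) ≡ 1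
  even = count-served-claimed-even k

private
  +-rearrange : ∀ a b c d → a + (b + c) + d ≡ a + b + (d + c)
  +-rearrange = solve-∀

count-idle-one-step : ∀ n → count idle 1 (3 + n) ≡ count served 0 n + count idle 0 n + count idle 1 (1 + n)
count-idle-one-step n = begin
  count idle 1 (3 + n)
    ≡⟨ count-idle 1 (2 + n) ⟩
  count ready 1 (2 + n) + count pending 1 (2 + n)
    ≡⟨ cong₂ _+_ (count-ready-suc 0 (1 + n)) (count-pending 1 (1 + n)) ⟩
  count ready 0 (1 + n) + count served 1 (1 + n) + count claimed 1 (1 + n)
    ≡⟨ cong₂ _+_ (cong₂ _+_ (count-ready-zero n) (count-served-suc 0 n)) (count-claimed 1 n) ⟩
  count served 0 n + (count idle 0 n + count pending 1 n) + count ready 1 n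
    ≡⟨ +-rearrange (count served 0 n) (count idle 0 n) (count pending 1 n) (count ready 1 n) ⟩
  count served 0 n + count idle 0 n + (count ready 1 n + count pending 1 n)
    ≡⟨ cong (count served 0 n + count idle 0 n +_) (count-idle 1 n) ⟨
  count served 0 n + count idle 0 n + count idle 1 (1 + n)
    ∎
  where open ≡-Reasoning

count-idle-odd : ∀ k → count idle 1 (1 + 2 * suc k) ≡ 3 * suc k
count-idle-odd zero    = refl
count-idle-odd (suc k) = subst (λ n → count idle 1 (suc n) ≡ 3 * suc (suc k)) (sym (*-suc 2 (suc k))) $ begin
  count idle 1 (3 + 2 * suc k)
    ≡⟨ count-idle-one-step (2 * suc k) ⟩
  count served 0 (2 * suc k) + count idle 0 (2 * suc k) + count idle 1 (1 + 2 * suc k)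
    ≡⟨ cong₂ _+_ (cong₂ _+_ (proj₁ (count-served-claimed-even (suc k))) (count-idle-even k))
                 (count-idle-odd k) ⟩
  3 + 3 * suc k
    ≡⟨ *-suc 3 (suc k) ⟨
  3 * suc (suc k)
    ∎
  where open ≡-Reasoning

-- Minimum super dominating sets

length≡suc⇒∃∈ : ∀ {A : Set} (xs : List A) {k} → length xs ≡ suc k → ∃ λ x → x ∈ₗ xs
length≡suc⇒∃∈ (x ∷ _) _ = x , here refl

nspIs-minimalSlack : ∀ {n} s₀ {k} → (∀ (T : Subset n) {t} → slack idle T ≡ just t → s₀ ≤ t) →
                     count idle s₀ n ≡ suc k → NspIs (Path n) (suc k)
nspIs-minimalSlack {n} s₀ minimal counted =
  minimum , counted , Unique.filter⁺ hits? (allSubsets-unique n) ,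
  λ S → mk⇔ (listed⇒minimum S) (minimum⇒listed S)
  where
  hits? : (S : Subset n) → Dec (slack idle S ≡ just s₀)
  hits? S = slack idle S ≟ₘ just s₀
  minimum : List (Subset n)
  minimum = fibre (slack idle) s₀ (allSubsets n)
  listed⇒slack : ∀ {S} → S ∈ₗ minimum → slack idle S ≡ just s₀
  listed⇒slack S∈ = proj₂ (∈-filter⁻ hits? {xs = allSubsets n} S∈)
  witness : Subset n
  witness = proj₁ (length≡suc⇒∃∈ minimum counted)
  witness-slack : slack idle witness ≡ just s₀
  witness-slack = listed⇒slack (proj₂ (length≡suc⇒∃∈ minimum counted))
  listed⇒minimum : ∀ S → S ∈ₗ minimum → MinSuperDominating (Path n) S
  listed⇒minimum S S∈ = slack⇒superDominating S (listed⇒slack S∈) , λ T sdT →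
    let t , eqT = superDominating⇒slack T sdT in
    Equivalence.from (card-≤⇔slack-≤ S T (listed⇒slack S∈) eqT) (minimal T eqT)
  minimum⇒listed : ∀ S → MinSuperDominating (Path n) S → S ∈ₗ minimum
  minimum⇒listed S (sdS , least) with superDominating⇒slack S sdS
  ... | s , eqS = ∈-filter⁺ hits? (∈-allSubsets S) (subst (λ s → slack idle S ≡ just s) s≡s₀ eqS)
    where
    s≡s₀ : s ≡ s₀
    s≡s₀ = ≤-antisym (Equivalence.to (card-≤⇔slack-≤ S witness eqS witness-slack)
                        (least witness (slack⇒superDominating witness witness-slack)))
                     (minimal S eqS)

theorem6p3 : ((k : ℕ) → k ≥ 1 → NspIs (Path (2 * k)) 2)
    × ((k : ℕ) → k ≥ 1 → NspIs (Path (1 + 2 * k)) (3 * k))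
    × NspIs (Path 1) 1
theorem6p3 = even , odd , single
  where
  even : (k : ℕ) → k ≥ 1 → NspIs (Path (2 * k)) 2
  even (suc k) _ = nspIs-minimalSlack 0 (λ _ _ → z≤n) (count-idle-even k)
  odd : (k : ℕ) → k ≥ 1 → NspIs (Path (1 + 2 * k)) (3 * k)
  odd (suc k) _ = nspIs-minimalSlack 1 (slack-odd-positive (suc k)) (count-idle-odd k)
  single : NspIs (Path 1) 1
  single = nspIs-minimalSlack 1 (slack-odd-positive 0) refl
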